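{- Let $G$ be a connected graph on $n$ vertices with minimum degree $\delta(G) \geq d$ and $n > 3d$. Suppose there exist vertices $u, v \in V(G)$ with $\operatorname{dist}(u,v) = 3$ such that $B_4(u) \neq V(G)$, $B_4(v) \neq V(G)$ and $B_2(u) \cup B_2(v) = V(G)$. Then $G^4$ has average degree at least $\frac{7}{3}d$.
   Context: All graphs are finite, simple and connected. For a graph $G$ and a positive integer $k$, the $k$th power $G^k$ is the graph with vertex set $V(G)$ in which two distinct vertices are adjacent if and only if their distance in $G$ is at most $k$. For a vertex $v$ and nonnegative integer $k$, the ball $B_k(v) = \{u \in V(G) : \operatorname{dist}(u,v) \leq k\}$. -}

module Defs where

open import Data.Nat using (ℕ; zero; suc; _+_; _*_; _≤_; _<_)
open import Data.Fin using (Fin)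
open import Data.Fin.Properties using (_≟_)
open import Data.Bool using (Bool; true; false; _∧_; _∨_; not)
open import Data.List using (List; map; allFin)
open import Data.Nat.ListAction using (sum)
open import Data.Bool.ListAction using (any)
open import Data.Product using (Σ; ∃; _×_)
open import Relation.Nullary.Decidable using (⌊_⌋)
open import Relation.Binary.PropositionalEquality using (_≡_)

record Graph (n : ℕ) : Set where
  field
    adj   : Fin n → Fin n → Bool
    sym   : ∀ u v → adj u v ≡ adj v u
    irrefl : ∀ v → adj v v ≡ false

open Graph public

-- within G k u v = true  iff  dist_G(u,v) ≤ k
-- (there is a walk of length at most k from u to v).
within : ∀ {n} → Graph n → ℕ → Fin n → Fin n → Bool
within G zero    u v = ⌊ u ≟ v ⌋
within {n} G (suc k) u v =
  within G k u v ∨ any (λ w → adj G u w ∧ within G k w v) (allFin n)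

Connected : ∀ {n} → Graph n → Set
Connected G = ∀ u v → ∃ λ k → within G k u v ≡ true

count : ∀ {n} → (Fin n → Bool) → ℕ
count {n} P = sum (map (λ w → if P w then 1 else 0) (allFin n))
  where open import Data.Bool using (if_then_else_)

degree : ∀ {n} → Graph n → Fin n → ℕ
degree G v = count (adj G v)

powDegree : ∀ {n} → Graph n → ℕ → Fin n → ℕ
powDegree G k v = count (λ w → not ⌊ v ≟ w ⌋ ∧ within G k v w)

-- sum of all degrees of G^k (= n · average degree of G^k)
powDegreeSum : ∀ {n} → Graph n → ℕ → ℕ
powDegreeSum {n} G k = sum (map (powDegree G k) (allFin n))

module Submission where

-- Let A = B₂(u) and B = B₂(v).  Since B₂(u) ∪ B₂(v) = V, the vertices
-- split into the three regions A∖B, B∖A and A∩B, of sizes α, β, γ.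
-- Writing m = d + 1 for the minimum size of a closed neighbourhood N[·],
-- the proof double counts Σ_w |B₄(w)| = n + Σ_w deg_{G⁴}(w):
--   * a vertex of A∩B sees every vertex within distance 4;
--   * a vertex of A∖B sees all of A, and if it lies in N[x₁], where x₁ is
--     the neighbour of u on a shortest u–v path, also all of N[v]∖A;
--   * symmetrically for B∖A with x₂ and N[u]∖B.
-- The closed neighbourhoods of a vertex a far from v, of x₁, of u, of v
-- (and their mirror images) give linear lower bounds on α, β, γ and on
-- the sizes of the regions above; a purely arithmetic inequality then
-- turns the double count into 7(d+1)n ≤ 3(n + Σ deg_{G⁴}).

open import Defs renaming (sym to adj-sym)
open import Data.Nat using (ℕ; zero; suc; _+_; _*_; _≤_; _<_; z≤n; s≤s)
open import Data.Nat.Properties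
  using ( ≤-trans; ≤-reflexive; +-mono-≤; +-monoˡ-≤; +-monoʳ-≤; +-identityʳ; *-monoʳ-≤
        ; *-monoˡ-≤; m≤m+n; +-comm; +-cancelʳ-≤; _≤?_; ≰⇒>
        ; <⇒≤; m≤n⇒∃[o]m+o≡n; +-0-commutativeMonoid; module ≤-Reasoning)
open import Data.Nat.ListAction using (sum)
open import Data.Nat.Tactic.RingSolver using (solve-∀)
open import Data.Fin using (Fin; zero; suc)
open import Data.Fin.Properties using (_≟_)
open import Data.Bool using (Bool; true; false; _∧_; _∨_; not; if_then_else_)
open import Data.Bool.Properties using (∧-comm; ∧-zeroʳ; ∧-identityʳ; ∨-identityʳ; ∨-zeroʳ; ∨-comm; T-≡)
open import Data.Bool.ListAction using (any)
open import Data.List using (map; allFin; tabulate)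
open import Data.List.Properties using (map-tabulate)
open import Data.List.Relation.Unary.Any using (satisfied)
open import Data.List.Relation.Unary.Any.Properties using (any⁺; any⁻)
open import Data.List.Membership.Propositional using (lose)
open import Data.List.Membership.Propositional.Properties using (∈-allFin)
open import Data.Product using (∃; _×_; _,_)
open import Data.Sum using (_⊎_; inj₁; inj₂)
open import Data.Empty using (⊥; ⊥-elim)
open import Function using (_∘_; id)
open import Function.Bundles using (Equivalence)
open import Relation.Nullary using (yes; no)
open import Relation.Nullary.Decidable using (⌊_⌋)
open import Relation.Binary.PropositionalEquality
  using (_≡_; refl; sym; trans; cong; cong₂; subst; subst₂; module ≡-Reasoning)
open import Algebra.Properties.CommutativeMonoid.Sum +-0-commutativeMonoid
  using (sum-cong-≗; ∑-distrib-+) renaming (sum to ∑)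

open Equivalence using (to; from)

private
  variable
    n : ℕ

infix 8 _·_
_·_ : Bool → ℕ → ℕ
b · c = if b then c else 0

·-distrib-+ : ∀ b x y → b · (x + y) ≡ b · x + b · y
·-distrib-+ true  x y = refl
·-distrib-+ false x y = refl

·-∧ : ∀ a b c → a · (b · c) ≡ (a ∧ b) · c
·-∧ true  b c = refl
·-∧ false b c = refl

sum-mono : {f g : Fin n → ℕ} → (∀ w → f w ≤ g w) → ∑ f ≤ ∑ g
sum-mono {zero}  f≤g = z≤n
sum-mono {suc n} f≤g = +-mono-≤ (f≤g zero) (sum-mono (f≤g ∘ suc))

sum-allFin : (f : Fin n → ℕ) → sum (map f (allFin n)) ≡ ∑ f
sum-allFin f = trans (cong sum (map-tabulate id f)) (sum-tabulate f)
  where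
  sum-tabulate : ∀ {k} (g : Fin k → ℕ) → sum (tabulate g) ≡ ∑ g
  sum-tabulate {zero}  g = refl
  sum-tabulate {suc k} g = cong (g zero +_) (sum-tabulate (g ∘ suc))

count≡∑ : (P : Fin n → Bool) → count P ≡ ∑ (λ w → P w · 1)
count≡∑ P = sum-allFin (λ w → P w · 1)

sum-·-const : (P : Fin n → Bool) (c : ℕ) → ∑ (λ w → P w · c) ≡ count P * c
sum-·-const P c = trans (weighted P) (cong (_* c) (sym (count≡∑ P)))
  where
  weighted : ∀ {k} (Q : Fin k → Bool) → ∑ (λ w → Q w · c) ≡ ∑ (λ w → Q w · 1) * c
  weighted {zero}  Q = refl
  weighted {suc k} Q with Q zero
  ... | true  = cong (c +_) (weighted (Q ∘ suc))
  ... | false = weighted (Q ∘ suc)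

sum-·-mono : (P : Fin n → Bool) {f g : Fin n → ℕ} →
             (∀ w → P w ≡ true → f w ≤ g w) →
             ∑ (λ w → P w · f w) ≤ ∑ (λ w → P w · g w)
sum-·-mono P {f} {g} f≤g = sum-mono pointwise
  where
  pointwise : ∀ w → P w · f w ≤ P w · g w
  pointwise w with P w in Pw
  ... | true  = f≤g w Pw
  ... | false = z≤n

infixl 7 _∩_ _∖_
_∩_ _∖_ : (Fin n → Bool) → (Fin n → Bool) → (Fin n → Bool)
(P ∩ Q) w = P w ∧ Q w
(P ∖ Q) w = P w ∧ not (Q w)

infix 4 _⊆_
_⊆_ : (Fin n → Bool) → (Fin n → Bool) → Set
P ⊆ Q = ∀ w → P w ≡ true → Q w ≡ true

Disjoint : (Fin n → Bool) → (Fin n → Bool) → Set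
Disjoint P Q = ∀ w → P w ≡ true → Q w ≡ true → ⊥

⊆-trans : {P Q R : Fin n → Bool} → P ⊆ Q → Q ⊆ R → P ⊆ R
⊆-trans P⊆Q Q⊆R w = Q⊆R w ∘ P⊆Q w

∩-⊆ˡ : {P Q : Fin n → Bool} → P ∩ Q ⊆ P
∩-⊆ˡ {P = P} w PQw with P w
... | true = refl

∩-⊆ʳ : {P Q : Fin n → Bool} → P ∩ Q ⊆ Q
∩-⊆ʳ {P = P} w PQw with P w
... | true = PQw

∖-⊆ : {P Q : Fin n → Bool} → P ∖ Q ⊆ P
∖-⊆ {P = P} w PQw with P w
... | true = refl

⊆-∩ : {P Q R : Fin n → Bool} → P ⊆ Q → P ⊆ R → P ⊆ Q ∩ R
⊆-∩ P⊆Q P⊆R w Pw rewrite P⊆Q w Pw = P⊆R w Pw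

∩-monoˡ : {P Q R : Fin n → Bool} → P ⊆ Q → P ∩ R ⊆ Q ∩ R
∩-monoˡ P⊆Q = ⊆-∩ (⊆-trans ∩-⊆ˡ P⊆Q) ∩-⊆ʳ

∖-monoˡ : {P Q R : Fin n → Bool} → P ⊆ Q → P ∖ R ⊆ Q ∖ R
∖-monoˡ {P = P} {Q} {R} P⊆Q w PRw with P w in Pw | R w
∖-monoˡ {P = P} {Q} {R} P⊆Q w () | true | true
... | true | false = trans (∧-identityʳ (Q w)) (P⊆Q w Pw)

∖-disjoint : {P Q : Fin n → Bool} → Disjoint Q (P ∖ Q)
∖-disjoint {P = P} w Qw PQw rewrite Qw | ∧-zeroʳ (P w) with PQw
... | ()

count-cong : {P Q : Fin n → Bool} → (∀ w → P w ≡ Q w) → count P ≡ count Q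
count-cong {P = P} {Q} P≗Q = begin
  count P              ≡⟨ count≡∑ P ⟩
  ∑ (λ w → P w · 1)    ≡⟨ sum-cong-≗ (λ w → cong (_· 1) (P≗Q w)) ⟩
  ∑ (λ w → Q w · 1)    ≡⟨ count≡∑ Q ⟨
  count Q              ∎
  where open ≡-Reasoning

sum-ones : ∀ n → ∑ {n} (λ _ → 1) ≡ n
sum-ones zero    = refl
sum-ones (suc n) = cong suc (sum-ones n)

count-full : count {n} (λ _ → true) ≡ n
count-full {n} = trans (count≡∑ {n} (λ _ → true)) (sum-ones n)

count-singleton : (c : Fin n) → count (λ w → ⌊ c ≟ w ⌋) ≡ 1
count-singleton c = trans (count≡∑ (λ w → ⌊ c ≟ w ⌋)) (single c)
  where
  suc-≟ : ∀ {k} (x y : Fin k) → ⌊ suc x ≟ suc y ⌋ ≡ ⌊ x ≟ y ⌋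
  suc-≟ x y with x ≟ y
  ... | yes _ = refl
  ... | no  _ = refl
  single : ∀ {k} (x : Fin k) → ∑ (λ w → ⌊ x ≟ w ⌋ · 1) ≡ 1
  single {suc k} zero    = cong suc (zeros k)
    where
    zeros : ∀ j → ∑ {j} (λ _ → 0) ≡ 0
    zeros zero    = refl
    zeros (suc j) = zeros j
  single {suc k} (suc x) =
    trans (sum-cong-≗ (λ w → cong (_· 1) (suc-≟ x w))) (single x)

count-mono : {P Q : Fin n → Bool} → P ⊆ Q → count P ≤ count Q
count-mono {P = P} {Q} P⊆Q =
  subst₂ _≤_ (sym (count≡∑ P)) (sym (count≡∑ Q)) (sum-mono pointwise)
  where
  pointwise : ∀ w → P w · 1 ≤ Q w · 1
  pointwise w with P w in Pw
  ... | true  = ≤-reflexive (cong (_· 1) (sym (P⊆Q w Pw)))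
  ... | false = z≤n

count-disjoint : {P Q R : Fin n → Bool} → Disjoint P Q → P ⊆ R → Q ⊆ R →
                 count P + count Q ≤ count R
count-disjoint {P = P} {Q} {R} P∩Q=∅ P⊆R Q⊆R = begin
  count P + count Q                     ≡⟨ cong₂ _+_ (count≡∑ P) (count≡∑ Q) ⟩
  ∑ (λ w → P w · 1) + ∑ (λ w → Q w · 1) ≡⟨ ∑-distrib-+ (λ w → P w · 1) (λ w → Q w · 1) ⟨
  ∑ (λ w → P w · 1 + Q w · 1)           ≤⟨ sum-mono pointwise ⟩
  ∑ (λ w → R w · 1)                     ≡⟨ count≡∑ R ⟨
  count R                               ∎
  where
  open ≤-Reasoning
  pointwise : ∀ w → P w · 1 + Q w · 1 ≤ R w · 1
  pointwise w with P w in Pw | Q w in Qw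
  ... | true  | true  = ⊥-elim (P∩Q=∅ w Pw Qw)
  ... | true  | false = ≤-reflexive (cong (_· 1) (sym (P⊆R w Pw)))
  ... | false | true  = ≤-reflexive (cong (_· 1) (sym (Q⊆R w Qw)))
  ... | false | false = z≤n

count-split : (P Q : Fin n → Bool) → count P ≡ count (P ∖ Q) + count (P ∩ Q)
count-split P Q = begin
  count P                                         ≡⟨ count≡∑ P ⟩
  ∑ (λ w → P w · 1)                               ≡⟨ sum-cong-≗ pointwise ⟩
  ∑ (λ w → (P ∖ Q) w · 1 + (P ∩ Q) w · 1)         ≡⟨ ∑-distrib-+ (λ w → (P ∖ Q) w · 1) (λ w → (P ∩ Q) w · 1) ⟩
  ∑ (λ w → (P ∖ Q) w · 1) + ∑ (λ w → (P ∩ Q) w · 1)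
    ≡⟨ cong₂ _+_ (count≡∑ (P ∖ Q)) (count≡∑ (P ∩ Q)) ⟨
  count (P ∖ Q) + count (P ∩ Q)                   ∎
  where
  open ≡-Reasoning
  pointwise : ∀ w → P w · 1 ≡ (P ∖ Q) w · 1 + (P ∩ Q) w · 1
  pointwise w with P w | Q w
  ... | true  | true  = refl
  ... | true  | false = refl
  ... | false | _     = refl

count-∩-comm : (P Q : Fin n → Bool) → count (P ∩ Q) ≡ count (Q ∩ P)
count-∩-comm P Q = count-cong (λ w → ∧-comm (P w) (Q w))

sum-regions : (P Q : Fin n → Bool) → (∀ w → (P w ∨ Q w) ≡ true) →
              (g : Fin n → ℕ) →
              ∑ g ≡ ∑ (λ w → (P ∖ Q) w · g w) + ∑ (λ w → (Q ∖ P) w · g w)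
                    + ∑ (λ w → (P ∩ Q) w · g w)
sum-regions P Q cover g = begin
  ∑ g                                              ≡⟨ sum-cong-≗ pointwise ⟩
  ∑ (λ w → onlyP w + onlyQ w + both w)             ≡⟨ ∑-distrib-+ (λ w → onlyP w + onlyQ w) both ⟩
  ∑ (λ w → onlyP w + onlyQ w) + ∑ both             ≡⟨ cong (_+ ∑ both) (∑-distrib-+ onlyP onlyQ) ⟩
  ∑ onlyP + ∑ onlyQ + ∑ both                       ∎
  where
  open ≡-Reasoning
  onlyP onlyQ both : Fin _ → ℕ
  onlyP w = (P ∖ Q) w · g w
  onlyQ w = (Q ∖ P) w · g w
  both  w = (P ∩ Q) w · g w
  pointwise : ∀ w → g w ≡ onlyP w + onlyQ w + both w
  pointwise w with P w | Q w | cover w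
  ... | true  | true  | _ = refl
  ... | true  | false | _ = sym (trans (+-identityʳ (g w + 0)) (+-identityʳ (g w)))
  ... | false | true  | _ = sym (+-identityʳ (g w))

sum-two-level : (S T : Fin n → Bool) (c e : ℕ) →
                ∑ (λ w → S w · (c + T w · e)) ≡ count S * c + count (S ∩ T) * e
sum-two-level S T c e = begin
  ∑ (λ w → S w · (c + T w · e))                     ≡⟨ sum-cong-≗ pointwise ⟩
  ∑ (λ w → S w · c + (S ∩ T) w · e)                 ≡⟨ ∑-distrib-+ (λ w → S w · c) (λ w → (S ∩ T) w · e) ⟩
  ∑ (λ w → S w · c) + ∑ (λ w → (S ∩ T) w · e)       ≡⟨ cong₂ _+_ (sum-·-const S c) (sum-·-const (S ∩ T) e) ⟩
  count S * c + count (S ∩ T) * e                   ∎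
  where
  open ≡-Reasoning
  pointwise : ∀ w → S w · (c + T w · e) ≡ S w · c + (S ∩ T) w · e
  pointwise w = trans (·-distrib-+ (S w) c (T w · e)) (cong (S w · c +_) (·-∧ (S w) (T w) e))

false≢true : ∀ {b} → b ≡ false → b ≡ true → ⊥
false≢true refl ()

any-allFin-intro : (p : Fin n → Bool) (w : Fin n) → p w ≡ true → any p (allFin n) ≡ true
any-allFin-intro p w pw = to T-≡ (any⁺ p (lose (∈-allFin w) (from T-≡ pw)))

any-allFin-elim : (p : Fin n → Bool) → any p (allFin n) ≡ true → ∃ λ w → p w ≡ true
any-allFin-elim {n} p h with satisfied (any⁻ p (allFin n) (from T-≡ h))
... | w , pw = w , to T-≡ pw

module Distance (G : Graph n) where

  viaNeighbour : ℕ → Fin n → Fin n → Bool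
  viaNeighbour k x y = any (λ z → adj G x z ∧ within G k z y) (allFin n)

  within-refl : ∀ k x → within G k x x ≡ true
  within-refl zero    x with x ≟ x
  ... | yes _  = refl
  ... | no x≢x = ⊥-elim (x≢x refl)
  within-refl (suc k) x = cong (_∨ viaNeighbour k x x) (within-refl k x)

  within-zero : ∀ {x y} → within G 0 x y ≡ true → x ≡ y
  within-zero {x} {y} h with x ≟ y
  ... | yes x≡y = x≡y

  within-weaken : ∀ {k x y} → within G k x y ≡ true → within G (suc k) x y ≡ true
  within-weaken {k} {x} {y} h = cong (_∨ viaNeighbour k x y) h

  within-step : ∀ {k x w y} → adj G x w ≡ true → within G k w y ≡ true →
                within G (suc k) x y ≡ true
  within-step {k} {x} {w} {y} xw wy =
    trans (cong (within G k x y ∨_)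
                (any-allFin-intro (λ z → adj G x z ∧ within G k z y) w (cong₂ _∧_ xw wy)))
          (∨-zeroʳ _)

  within-inv : ∀ k {x y} → within G (suc k) x y ≡ true →
               within G k x y ≡ true ⊎ ∃ λ w → adj G x w ≡ true × within G k w y ≡ true
  within-inv k {x} {y} h with within G k x y
  ... | true  = inj₁ refl
  ... | false with any-allFin-elim (λ z → adj G x z ∧ within G k z y) h
  ...   | w , xwy with adj G x w in xw | within G k w y in wy
  ...     | true | true = inj₂ (w , xw , wy)

  within-adj : ∀ {x y} → adj G x y ≡ true → within G 1 x y ≡ true
  within-adj {x} {y} xy = within-step {0} {x} {y} {y} xy (within-refl 0 y)

  within-trans : ∀ j k {x} y {z} → within G j x y ≡ true → within G k y z ≡ true →
                 within G (j + k) x z ≡ true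
  within-trans zero    k y xy yz rewrite within-zero xy = yz
  within-trans (suc j) k {x} y {z} xy yz with within-inv j xy
  ... | inj₁ xy′          = within-weaken {j + k} {x} {z} (within-trans j k y xy′ yz)
  ... | inj₂ (w , xw , wy) = within-step {j + k} {x} {w} {z} xw (within-trans j k y wy yz)

  within-mono : ∀ {j k x y} → j ≤ k → within G j x y ≡ true → within G k x y ≡ true
  within-mono {j} {k} {y = y} j≤k xy with m≤n⇒∃[o]m+o≡n j≤k
  ... | o , refl = within-trans j o y xy (within-refl o y)

  within-sym : ∀ k {x y} → within G k x y ≡ true → within G k y x ≡ true
  within-sym zero xy rewrite within-zero xy = within-refl 0 _
  within-sym (suc k) {x} {y} xy with within-inv k xy
  ... | inj₁ xy′          = within-weaken {k} {y} {x} (within-sym k xy′)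
  ... | inj₂ (w , xw , wy) =
    subst (λ i → within G i y x ≡ true) (+-comm k 1)
          (within-trans k 1 w (within-sym k wy) (within-adj (trans (adj-sym G w x) xw)))

  first-step : ∀ {x y} → within G 3 x y ≡ true → within G 2 x y ≡ false →
               ∃ λ z → adj G x z ≡ true × within G 2 z y ≡ true
  first-step x≤3y x≰2y with within-inv 2 x≤3y
  ... | inj₁ x≤2y = ⊥-elim (false≢true x≰2y x≤2y)
  ... | inj₂ step = step

  within-sym-false : ∀ k {x y} → within G k x y ≡ false → within G k y x ≡ false
  within-sym-false k {x} {y} x≰y with within G k y x in y≤x
  ... | false = refl
  ... | true  = ⊥-elim (false≢true x≰y (within-sym k y≤x))

  closedNbhd-size : ∀ {d} x → d ≤ degree G x → suc d ≤ count (within G 1 x)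
  closedNbhd-size {d} x d≤deg = begin
    suc d                                  ≤⟨ s≤s d≤deg ⟩
    1 + degree G x                         ≡⟨ cong (_+ degree G x) (count-singleton x) ⟨
    count (within G 0 x) + count (adj G x) ≤⟨ count-disjoint x≢nbr self⊆N nbr⊆N ⟩
    count (within G 1 x)                   ∎
    where
    open ≤-Reasoning
    x≢nbr : Disjoint (within G 0 x) (adj G x)
    x≢nbr w x≡w xw with within-zero x≡w
    ... | refl with trans (sym (Graph.irrefl G x)) xw
    ...   | ()
    self⊆N : within G 0 x ⊆ within G 1 x
    self⊆N w = within-weaken {0} {x} {w}
    nbr⊆N : adj G x ⊆ within G 1 x
    nbr⊆N w = within-adj

  ball-size : ∀ k w → count (within G k w) ≡ suc (powDegree G k w)
  ball-size k w = begin
    count ball                                         ≡⟨ count-split ball centre ⟩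
    count (ball ∖ centre) + count (ball ∩ centre)      ≡⟨ cong₂ _+_ punctured only-centre ⟩
    powDegree G k w + 1                                ≡⟨ +-comm (powDegree G k w) 1 ⟩
    suc (powDegree G k w)                              ∎
    where
    open ≡-Reasoning
    ball centre : Fin _ → Bool
    ball   = within G k w
    centre = within G 0 w
    punctured : count (ball ∖ centre) ≡ powDegree G k w
    punctured = count-cong (λ y → ∧-comm (ball y) (not (centre y)))
    only-centre : count (ball ∩ centre) ≡ 1
    only-centre = trans (count-cong pointwise) (count-singleton w)
      where
      pointwise : ∀ y → ball y ∧ centre y ≡ centre y
      pointwise y with centre y in w≡y
      ... | false = ∧-zeroʳ (ball y)
      ... | true with within-zero {w} {y} w≡y
      ...   | refl = cong (_∧ true) (within-refl k w)

  ball-sum : ∀ k → ∑ (λ w → count (within G k w)) ≡ n + powDegreeSum G k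
  ball-sum k = begin
    ∑ (λ w → count (within G k w))        ≡⟨ sum-cong-≗ (ball-size k) ⟩
    ∑ (λ w → 1 + powDegree G k w)         ≡⟨ ∑-distrib-+ {n} (λ _ → 1) (powDegree G k) ⟩
    ∑ {n} (λ _ → 1) + ∑ (powDegree G k)   ≡⟨ cong₂ _+_ (sum-ones n) (sym (sum-allFin (powDegree G k))) ⟩
    n + powDegreeSum G k                  ∎
    where open ≡-Reasoning

-- The proof distinguishes γ ≥ m from γ < m;
-- in each case, after writing every variable as its lower bound plus a
-- slack, the claim becomes a polynomial identity with a non-negative
-- remainder.

private
  large-overlap-identity : ∀ m x y g →
    3 * ((m + x) * (m + m) + (m + y) * (m + m) + (m + g) * (m + x + (m + y) + (m + g)))
    ≡ 7 * m * (m + x + (m + y) + (m + g))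
      + (2 * m * (x + y) + 5 * m * g + 3 * g * (x + y) + 3 * g * g)
  large-overlap-identity = solve-∀

  small-overlap-identity : ∀ γ t x y →
    3 * ((γ + t + t + x) * (γ + t + t + x + γ) + (γ + t + t + y) * (γ + t + t + y + γ)
         + t * (γ + t + t) + γ * (γ + t + t + x + (γ + t + t + y) + γ))
    ≡ 7 * (γ + t) * (γ + t + t + x + (γ + t + t + y) + γ)
      + (2 * γ * t + 2 * t * t + 5 * γ * (x + y) + 5 * t * (x + y) + 3 * x * x + 3 * y * y)
  small-overlap-identity = solve-∀

  regroup : ∀ a b c t u v → a + b + t * (u + v) + c ≡ (a + t * v) + (b + t * u) + c
  regroup = solve-∀

  cancel-overlap : ∀ γ t s → γ + t ≤ s + γ → t ≤ s
  cancel-overlap γ t s h = +-cancelʳ-≤ γ t s (subst (_≤ s + γ) (+-comm γ t) h)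

  cancel-overlap₂ : ∀ γ t s → (γ + t) + (γ + t) ≤ s + γ → γ + t + t ≤ s
  cancel-overlap₂ γ t s h = +-cancelʳ-≤ γ (γ + t + t) s (subst (_≤ s + γ) (double-shift γ t) h)
    where
    double-shift : ∀ γ t → (γ + t) + (γ + t) ≡ (γ + t + t) + γ
    double-shift = solve-∀

  large-overlap : ∀ m x y g q r cU cV →
    m + m ≤ (m + x) + (m + g) → m + m ≤ (m + y) + (m + g) →
    let α = m + x; β = m + y; γ = m + g; N = α + β + γ in
    7 * m * N ≤ 3 * ((α * (α + γ) + q * cV) + (β * (β + γ) + r * cU) + γ * N)
  large-overlap m x y g q r cU cV 2m≤|A| 2m≤|B| = begin
    7 * m * N                                    ≤⟨ m≤m+n (7 * m * N) _ ⟩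
    7 * m * N + _                                ≡⟨ large-overlap-identity m x y g ⟨
    3 * (α * (m + m) + β * (m + m) + γ * N)      ≤⟨ *-monoʳ-≤ 3 (+-monoˡ-≤ (γ * N) (+-mono-≤ left right)) ⟩
    3 * ((α * (α + γ) + q * cV) + (β * (β + γ) + r * cU) + γ * N) ∎
    where
    open ≤-Reasoning
    α = m + x; β = m + y; γ = m + g; N = α + β + γ
    left : α * (m + m) ≤ α * (α + γ) + q * cV
    left = ≤-trans (*-monoʳ-≤ α 2m≤|A|) (m≤m+n _ _)
    right : β * (m + m) ≤ β * (β + γ) + r * cU
    right = ≤-trans (*-monoʳ-≤ β 2m≤|B|) (m≤m+n _ _)

  small-overlap : ∀ γ t x y q r cU cV → t ≤ q → t ≤ r → γ + t + t ≤ cU + cV →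
    let α = γ + t + t + x; β = γ + t + t + y; N = α + β + γ in
    7 * (γ + t) * N ≤ 3 * ((α * (α + γ) + q * cV) + (β * (β + γ) + r * cU) + γ * N)
  small-overlap γ t x y q r cU cV t≤q t≤r UV = begin
    7 * (γ + t) * N
      ≤⟨ m≤m+n (7 * (γ + t) * N) _ ⟩
    7 * (γ + t) * N + _
      ≡⟨ small-overlap-identity γ t x y ⟨
    3 * (α * (α + γ) + β * (β + γ) + t * (γ + t + t) + γ * N)
      ≤⟨ *-monoʳ-≤ 3 (+-monoˡ-≤ (γ * N) (+-monoʳ-≤ (α * (α + γ) + β * (β + γ)) (*-monoʳ-≤ t UV))) ⟩
    3 * (α * (α + γ) + β * (β + γ) + t * (cU + cV) + γ * N)
      ≡⟨ cong (3 *_) (regroup (α * (α + γ)) (β * (β + γ)) (γ * N) t cU cV) ⟩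
    3 * ((α * (α + γ) + t * cV) + (β * (β + γ) + t * cU) + γ * N)
      ≤⟨ *-monoʳ-≤ 3 (+-monoˡ-≤ (γ * N) (+-mono-≤ (+-monoʳ-≤ (α * (α + γ)) (*-monoˡ-≤ cV t≤q))
                                                 (+-monoʳ-≤ (β * (β + γ)) (*-monoˡ-≤ cU t≤r)))) ⟩
    3 * ((α * (α + γ) + q * cV) + (β * (β + γ) + r * cU) + γ * N)  ∎
    where
    open ≤-Reasoning
    α = γ + t + t + x; β = γ + t + t + y; N = α + β + γ

region-inequality : ∀ (m α β γ q r cU cV : ℕ) →
  m ≤ α → m ≤ β → m + m ≤ α + γ → m + m ≤ β + γ →
  m ≤ q + γ → m ≤ r + γ → m + m ≤ cU + cV + γ →
  7 * m * (α + β + γ) ≤ 3 * ((α * (α + γ) + q * cV) + (β * (β + γ) + r * cU) + γ * (α + β + γ))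
region-inequality m α β γ q r cU cV m≤α m≤β 2m≤|A| 2m≤|B| m≤q+γ m≤r+γ 2m≤UV with m ≤? γ
... | yes m≤γ with m≤n⇒∃[o]m+o≡n m≤α | m≤n⇒∃[o]m+o≡n m≤β | m≤n⇒∃[o]m+o≡n m≤γ
...   | x , refl | y , refl | g , refl = large-overlap m x y g q r cU cV 2m≤|A| 2m≤|B|
region-inequality m α β γ q r cU cV m≤α m≤β 2m≤|A| 2m≤|B| m≤q+γ m≤r+γ 2m≤UV
  | no m≰γ with m≤n⇒∃[o]m+o≡n (<⇒≤ (≰⇒> m≰γ))
... | t , refl with m≤n⇒∃[o]m+o≡n (cancel-overlap₂ γ t α 2m≤|A|)
                 | m≤n⇒∃[o]m+o≡n (cancel-overlap₂ γ t β 2m≤|B|)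
...   | x , refl | y , refl =
  small-overlap γ t x y q r cU cV (cancel-overlap γ t q m≤q+γ) (cancel-overlap γ t r m≤r+γ)
                (cancel-overlap₂ γ t (cU + cV) 2m≤UV)

-- Passing from closed balls to G⁴-degrees: each vertex lies in its own
-- ball, which accounts for the extra n on the right.
drop-centres : ∀ d n P → 7 * suc d * n ≤ 3 * (n + P) → 7 * d * n ≤ 3 * P
drop-centres d n P h = ≤-trans (m≤m+n (7 * d * n) (4 * n)) (+-cancelʳ-≤ (3 * n) _ _ h′)
  where
  split-left : ∀ d n → 7 * suc d * n ≡ 7 * d * n + 4 * n + 3 * n
  split-left = solve-∀
  split-right : ∀ n P → 3 * (n + P) ≡ 3 * P + 3 * n
  split-right = solve-∀
  h′ : 7 * d * n + 4 * n + 3 * n ≤ 3 * P + 3 * n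
  h′ = subst₂ _≤_ (split-left d n) (split-right n P) h

module OneSide (G : Graph n) {d : ℕ} (minDeg : ∀ w → d ≤ degree G w)
  {u v x a : Fin n} (u~x : adj G u x ≡ true) (x≤2v : within G 2 x v ≡ true)
  (v≰4a : within G 4 v a ≡ false)
  (cover : ∀ w → (within G 2 u w ∨ within G 2 v w) ≡ true) where

  open Distance G

  A B : Fin n → Bool
  A = within G 2 u
  B = within G 2 v

  N : Fin n → Fin n → Bool
  N = within G 1

  N[a]∩B=∅ : Disjoint (N a) B
  N[a]∩B=∅ y a~y v≤2y =
    false≢true v≰4a (within-mono {3} {4} (s≤s (s≤s (s≤s z≤n)))
                       (within-trans 2 1 y v≤2y (within-sym 1 a~y)))

  N[a]⊆A∖B : N a ⊆ A ∖ B
  N[a]⊆A∖B y a~y with B y in v≤2y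
  ... | true  = ⊥-elim (N[a]∩B=∅ y a~y v≤2y)
  ... | false = trans (∧-identityʳ (A y))
                      (trans (sym (∨-identityʳ (A y))) (subst (λ b → (A y ∨ b) ≡ true) v≤2y (cover y)))

  N[x]⊆A : N x ⊆ A
  N[x]⊆A y x~y = within-trans 1 1 x (within-adj u~x) x~y

  -- a walk a – y – x ⇝ v of length 4 would contradict dist(v, a) > 4
  N[a]∩N[x]=∅ : Disjoint (N a) (N x)
  N[a]∩N[x]=∅ y a~y x~y =
    false≢true v≰4a (within-sym 4 (within-trans 2 2 x (within-trans 1 1 y a~y (within-sym 1 x~y)) x≤2v))

  exclusive-size : suc d ≤ count (A ∖ B)
  exclusive-size = ≤-trans (closedNbhd-size a (minDeg a)) (count-mono N[a]⊆A∖B)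

  -- N[a] and N[x] are disjoint inside A.
  ball-size-bound : suc d + suc d ≤ count (A ∖ B) + count (A ∩ B)
  ball-size-bound = begin
    suc d + suc d                  ≤⟨ +-mono-≤ (closedNbhd-size a (minDeg a)) (closedNbhd-size x (minDeg x)) ⟩
    count (N a) + count (N x)      ≤⟨ count-disjoint N[a]∩N[x]=∅ (⊆-trans N[a]⊆A∖B (∖-⊆ {P = A} {B})) N[x]⊆A ⟩
    count A                        ≡⟨ count-split A B ⟩
    count (A ∖ B) + count (A ∩ B)  ∎
    where open ≤-Reasoning

  -- N[x] ⊆ A, and its part inside B lies in A ∩ B.
  near-x-bound : suc d ≤ count ((A ∖ B) ∩ N x) + count (A ∩ B)
  near-x-bound = begin
    suc d                                   ≤⟨ closedNbhd-size x (minDeg x) ⟩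
    count (N x)                             ≡⟨ count-split (N x) B ⟩
    count (N x ∖ B) + count (N x ∩ B)       ≤⟨ +-mono-≤ (count-mono (⊆-∩ (∖-monoˡ N[x]⊆A) (∖-⊆ {P = N x} {B})))
                                                        (count-mono (∩-monoˡ N[x]⊆A)) ⟩
    count ((A ∖ B) ∩ N x) + count (A ∩ B)   ∎
    where open ≤-Reasoning

  A⊆B₄ : ∀ w → A w ≡ true → A ⊆ within G 4 w
  A⊆B₄ w u≤2w y u≤2y = within-trans 2 2 u (within-sym 2 u≤2w) u≤2y

  exclusive-ball : ∀ w → A w ≡ true →
                   count A + N x w · count (N v ∖ A) ≤ count (within G 4 w)
  exclusive-ball w u≤2w with N x w in x~w
  ... | true  = count-disjoint (∖-disjoint {P = N v} {A}) (A⊆B₄ w u≤2w) N[v]∖A⊆B₄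
    where
    N[v]∖A⊆B₄ : N v ∖ A ⊆ within G 4 w
    N[v]∖A⊆B₄ y vy∖A =
      within-trans 3 1 v (within-trans 1 2 x (within-sym 1 x~w) x≤2v) (∖-⊆ {P = N v} {A} y vy∖A)
  ... | false = subst (_≤ count (within G 4 w)) (sym (+-identityʳ (count A)))
                      (count-mono (A⊆B₄ w u≤2w))

  exclusive-sum : count (A ∖ B) * count A + count ((A ∖ B) ∩ N x) * count (N v ∖ A)
                  ≤ ∑ (λ w → (A ∖ B) w · count (within G 4 w))
  exclusive-sum = begin
    count (A ∖ B) * count A + count ((A ∖ B) ∩ N x) * count (N v ∖ A)
      ≡⟨ sum-two-level (A ∖ B) (N x) (count A) (count (N v ∖ A)) ⟨
    ∑ (λ w → (A ∖ B) w · (count A + N x w · count (N v ∖ A)))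
      ≤⟨ sum-·-mono (A ∖ B) (λ w w∈A∖B → exclusive-ball w (∖-⊆ {P = A} {B} w w∈A∖B)) ⟩
    ∑ (λ w → (A ∖ B) w · count (within G 4 w))  ∎
    where open ≤-Reasoning

module Configuration (G : Graph n) {d : ℕ} (minDeg : ∀ w → d ≤ degree G w)
  {u v x₁ x₂ a b : Fin n} (u≰2v : within G 2 u v ≡ false)
  (u~x₁ : adj G u x₁ ≡ true) (x₁≤2v : within G 2 x₁ v ≡ true)
  (v~x₂ : adj G v x₂ ≡ true) (x₂≤2u : within G 2 x₂ u ≡ true)
  (v≰4a : within G 4 v a ≡ false) (u≰4b : within G 4 u b ≡ false)
  (cover : ∀ w → (within G 2 u w ∨ within G 2 v w) ≡ true) where

  open Distance G
  module Side₁ = OneSide G minDeg u~x₁ x₁≤2v v≰4a cover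
  module Side₂ = OneSide G minDeg v~x₂ x₂≤2u u≰4b
                   (λ w → trans (∨-comm (within G 2 v w) (within G 2 u w)) (cover w))
  open Side₁ using (A; B; N)

  α β γ q r cU cV : ℕ
  α  = count (A ∖ B)
  β  = count (B ∖ A)
  γ  = count (A ∩ B)
  q  = count ((A ∖ B) ∩ N x₁)
  r  = count ((B ∖ A) ∩ N x₂)
  cU = count (N u ∖ B)
  cV = count (N v ∖ A)

  |A|≡ : count A ≡ α + γ
  |A|≡ = count-split A B

  |B|≡ : count B ≡ β + γ
  |B|≡ = trans (count-split B A) (cong (β +_) (count-∩-comm B A))

  n≡ : n ≡ α + β + γ
  n≡ = begin
    n                                                  ≡⟨ sum-ones n ⟨
    ∑ {n} (λ _ → 1)                                    ≡⟨ sum-regions A B cover (λ _ → 1) ⟩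
    ∑ (λ w → (A ∖ B) w · 1) + ∑ (λ w → (B ∖ A) w · 1)
      + ∑ (λ w → (A ∩ B) w · 1)                        ≡⟨ cong₂ _+_ (cong₂ _+_ (count≡∑ (A ∖ B)) (count≡∑ (B ∖ A)))
                                                                    (count≡∑ (A ∩ B)) ⟨
    α + β + γ                                          ∎
    where open ≡-Reasoning

  -- N[u] and N[v] are disjoint; their parts outside the other ball are
  -- counted by cU and cV, and the rest lies in A ∩ B.
  separated-nbhds : suc d + suc d ≤ cU + cV + γ
  separated-nbhds = begin
    suc d + suc d                                         ≤⟨ +-mono-≤ (closedNbhd-size u (minDeg u))
                                                                      (closedNbhd-size v (minDeg v)) ⟩
    count (N u) + count (N v)                             ≡⟨ cong₂ _+_ (count-split (N u) B) (count-split (N v) A) ⟩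
    (cU + count (N u ∩ B)) + (cV + count (N v ∩ A))       ≡⟨ interchange cU (count (N u ∩ B)) cV (count (N v ∩ A)) ⟩
    cU + cV + (count (N u ∩ B) + count (N v ∩ A))         ≤⟨ +-monoʳ-≤ (cU + cV)
                                                               (count-disjoint inner-disjoint
                                                                  (∩-monoˡ N[u]⊆A) (⊆-∩ ∩-⊆ʳ (⊆-trans ∩-⊆ˡ N[v]⊆B))) ⟩
    cU + cV + γ                                           ∎
    where
    open ≤-Reasoning
    interchange : ∀ a b c e → (a + b) + (c + e) ≡ a + c + (b + e)
    interchange = solve-∀
    N[u]⊆A : N u ⊆ A
    N[u]⊆A y = within-mono {1} {2} (s≤s z≤n)
    N[v]⊆B : N v ⊆ B
    N[v]⊆B y = within-mono {1} {2} (s≤s z≤n)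
    inner-disjoint : Disjoint (N u ∩ B) (N v ∩ A)
    inner-disjoint y uy vy =
      false≢true u≰2v (within-trans 1 1 y (∩-⊆ˡ {P = N u} {B} y uy) (within-sym 1 (∩-⊆ˡ {P = N v} {A} y vy)))

  -- Every vertex of A ∩ B is within distance 4 of all vertices.
  central-sum : γ * n ≤ ∑ (λ w → (A ∩ B) w · count (within G 4 w))
  central-sum = begin
    γ * n                                          ≡⟨ sum-·-const (A ∩ B) n ⟨
    ∑ (λ w → (A ∩ B) w · n)                        ≤⟨ sum-·-mono (A ∩ B) sees-all ⟩
    ∑ (λ w → (A ∩ B) w · count (within G 4 w))     ∎
    where
    open ≤-Reasoning
    sees-all : ∀ w → (A ∩ B) w ≡ true → n ≤ count (within G 4 w)
    sees-all w w∈A∩B = subst (_≤ count (within G 4 w)) count-full (count-mono everything)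
      where
      everything : (λ _ → true) ⊆ within G 4 w
      everything y _ with A y in u≤2y
      ... | true  = Side₁.A⊆B₄ w (∩-⊆ˡ {P = A} {B} w w∈A∩B) y u≤2y
      ... | false = Side₂.A⊆B₄ w (∩-⊆ʳ {P = A} {B} w w∈A∩B) y
                      (subst (λ c → (c ∨ B y) ≡ true) u≤2y (cover y))

  double-count : (α * count A + q * cV) + (β * count B + r * cU) + γ * n ≤ n + powDegreeSum G 4
  double-count = begin
    (α * count A + q * cV) + (β * count B + r * cU) + γ * n
      ≤⟨ +-mono-≤ (+-mono-≤ Side₁.exclusive-sum Side₂.exclusive-sum) central-sum ⟩
    ∑ (λ w → (A ∖ B) w · ball w) + ∑ (λ w → (B ∖ A) w · ball w) + ∑ (λ w → (A ∩ B) w · ball w)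
      ≡⟨ sum-regions A B cover ball ⟨
    ∑ ball
      ≡⟨ ball-sum 4 ⟩
    n + powDegreeSum G 4  ∎
    where
    open ≤-Reasoning
    ball : Fin n → ℕ
    ball w = count (within G 4 w)

  in-regions : ∀ {a a′ b b′ c c′} → a ≡ a′ → b ≡ b′ → c ≡ c′ →
    3 * ((α * a + q * cV) + (β * b + r * cU) + γ * c) ≡ 3 * ((α * a′ + q * cV) + (β * b′ + r * cU) + γ * c′)
  in-regions refl refl refl = refl

  closed-ball-bound : 7 * suc d * n ≤ 3 * (n + powDegreeSum G 4)
  closed-ball-bound = begin
    7 * suc d * n
      ≡⟨ cong (7 * suc d *_) n≡ ⟩
    7 * suc d * (α + β + γ)
      ≤⟨ region-inequality (suc d) α β γ q r cU cV
           Side₁.exclusive-size Side₂.exclusive-size Side₁.ball-size-bound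
           (subst (λ c → suc d + suc d ≤ β + c) (count-∩-comm B A) Side₂.ball-size-bound)
           Side₁.near-x-bound
           (subst (λ c → suc d ≤ r + c) (count-∩-comm B A) Side₂.near-x-bound)
           separated-nbhds ⟩
    3 * ((α * (α + γ) + q * cV) + (β * (β + γ) + r * cU) + γ * (α + β + γ))
      ≡⟨ in-regions |A|≡ |B|≡ n≡ ⟨
    3 * ((α * count A + q * cV) + (β * count B + r * cU) + γ * n)
      ≤⟨ *-monoʳ-≤ 3 double-count ⟩
    3 * (n + powDegreeSum G 4)  ∎
    where open ≤-Reasoning

lemma3p2 : ∀ (n d : ℕ) (G : Graph n) → Connected G
           → (∀ v → d ≤ degree G v)
           → 3 * d < n
           → (u v : Fin n)
           → within G 3 u v ≡ true → within G 2 u v ≡ false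
           → (∃ λ w → within G 4 u w ≡ false)
           → (∃ λ w → within G 4 v w ≡ false)
           → (∀ w → (within G 2 u w ∨ within G 2 v w) ≡ true)
           → 7 * d * n ≤ 3 * powDegreeSum G 4
lemma3p2 n d G _ minDeg _ u v u≤3v u≰2v (b , u≰4b) (a , v≰4a) cover
  with first-step u≤3v u≰2v | first-step (within-sym 3 u≤3v) (within-sym-false 2 u≰2v)
  where open Distance G
... | x₁ , u~x₁ , x₁≤2v | x₂ , v~x₂ , x₂≤2u =
  drop-centres d n (powDegreeSum G 4)
    (Configuration.closed-ball-bound G minDeg u≰2v u~x₁ x₁≤2v v~x₂ x₂≤2u v≰4a u≰4b cover)
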